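{- Define $a:\mathbb{Z}\to\mathbb{Z}$ by $a(n)=\left\lfloor \frac{n+1}{\sqrt{2}}\right\rfloor$ for $n\ge 1$ and $a(k)=0$ for $k<1$. Then \[ a\bigl(a(n)+a(n-1)\bigr)=n\qquad\text{for all integers } n\ge 1. \] -}

module Defs where

open import Data.Nat using (ℕ; zero; suc; _*_; _≤ᵇ_)
open import Data.Bool using (if_then_else_)
open import Data.Integer using (ℤ; +_; -[1+_])

-- floor (N / √2) for natural N, computed without reals:
-- for m ≥ 0,  m ≤ N/√2  ⇔  2·m² ≤ N².  floor(N/√2) is the largest such m,
-- and it is ≤ N, so we search downward from N.
floorDivSqrt2-go : ℕ → ℕ → ℕ
floorDivSqrt2-go N zero    = zero
floorDivSqrt2-go N (suc m) =
  if 2 * (suc m * suc m) ≤ᵇ N * N then suc m else floorDivSqrt2-go N m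

floorDivSqrt2 : ℕ → ℕ
floorDivSqrt2 N = floorDivSqrt2-go N N

a : ℤ → ℤ
a (+ zero)    = + 0
a (+ suc k)   = + floorDivSqrt2 (suc (suc k))
a -[1+ k ]    = + 0

-- Put q = ⌊n/√2⌋ and p = ⌊(n+1)/√2⌋, so that a n = p and a (n - 1) = q; the claim is that
-- ⌊(p+q+1)/√2⌋ = n. Over ℕ, m = ⌊N/√2⌋ means 2m² ≤ N² < 2(m+1)². Consecutive arguments differ
-- by 1/√2 < 1, so p = q or p = q + 1. If p = q, the bounds for n and n + 1 combine to bound
-- 2q + 1; if p = q + 1, doubling them bounds 2q + 2, where the strict upper bound needs
-- 2(q+1)² ≠ (n+1)², i.e. the irrationality of √2.
module Submission where

open import Defs
open import Relation.Binary.PropositionalEquality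
  using (_≡_; _≢_; refl; sym; trans; cong; subst; module ≡-Reasoning)

module FloorDivSqrt2Properties where

  open import Data.Bool using (true; false; T)
  open import Data.Empty using (⊥-elim)
  open import Function using (id)
  open import Data.List using ([]; _∷_)
  open import Data.Nat
  open import Data.Nat.Divisibility using (_∣_; divides)
  open import Data.Nat.Induction using (<-rec)
  open import Data.Nat.Primality using (euclidsLemma; prime[2])
  open import Data.Nat.Properties
  open import Data.Nat.Tactic.RingSolver using (solve)
  open import Data.Product using (_,_; ∃-syntax; uncurry)
  open import Data.Sum using (_⊎_; inj₁; inj₂; [_,_])
  open import Relation.Nullary using (yes; no)
  open import Relation.Binary.Definitions using (tri<; tri≈; tri>)

  m*m≤n*n⇒m≤n : ∀ {m n} → m * m ≤ n * n → m ≤ n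
  m*m≤n*n⇒m≤n h = ≮⇒≥ (λ n<m → <⇒≱ (*-mono-< n<m n<m) h)

  m*m<n*n⇒m<n : ∀ {m n} → m * m < n * n → m < n
  m*m<n*n⇒m<n h = ≰⇒> (λ n≤m → <⇒≱ h (*-mono-≤ n≤m n≤m))

  2∣n*n⇒2∣n : ∀ n → 2 ∣ n * n → 2 ∣ n
  2∣n*n⇒2∣n n 2∣n*n = [ id , id ] (euclidsLemma n n prime[2] 2∣n*n)

  2*m*m≡n*n⇒n≡0 : ∀ n m → 2 * (m * m) ≡ n * n → n ≡ 0
  2*m*m≡n*n⇒n≡0 = <-rec _ descent
    where
    descent : ∀ n → (∀ {k} → k < n → ∀ m → 2 * (m * m) ≡ k * k → k ≡ 0) →
              ∀ m → 2 * (m * m) ≡ n * n → n ≡ 0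
    descent zero      _   _         _  = refl
    descent (suc _)   _   zero      ()
    descent n@(suc _) rec m@(suc _) eq =
      ⊥-elim (1+n≢0 (uncurry (rec m<n) (smallerSolution (2∣n*n⇒2∣n n 2∣n*n))))
      where
      2∣n*n : 2 ∣ n * n
      2∣n*n = divides (m * m) (trans (sym eq) (*-comm 2 (m * m)))
      -- n = 2k turns 2m² = n² into m² = 2k², a solution with the smaller m in place of n.
      smallerSolution : 2 ∣ n → ∃[ k ] 2 * (k * k) ≡ m * m
      smallerSolution (divides k n≡k*2) = k , *-cancelˡ-≡ _ _ 2 (begin
        2 * (2 * (k * k)) ≡⟨ solve (k ∷ []) ⟩
        k * 2 * (k * 2)   ≡⟨ cong (λ x → x * x) n≡k*2 ⟨
        n * n             ≡⟨ eq ⟨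
        2 * (m * m)       ∎)
        where open ≡-Reasoning
      m<n : m < n
      m<n = m*m<n*n⇒m<n (subst (m * m <_) eq (m<m+n (m * m) z<s))

  record IsFloorDivSqrt2 (N m : ℕ) : Set where
    constructor bounds
    field
      lower : 2 * (m * m) ≤ N * N
      upper : N * N < 2 * (suc m * suc m)

  floorDivSqrt2-go-lower : ∀ N k → 2 * (floorDivSqrt2-go N k * floorDivSqrt2-go N k) ≤ N * N
  floorDivSqrt2-go-lower N zero = z≤n
  floorDivSqrt2-go-lower N (suc k) with 2 * (suc k * suc k) ≤ᵇ N * N in eq
  ... | true  = ≤ᵇ⇒≤ _ _ (subst T (sym eq) _)
  ... | false = floorDivSqrt2-go-lower N k

  floorDivSqrt2-go-upper : ∀ N k → N * N < 2 * (suc k * suc k) →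
                           N * N < 2 * (suc (floorDivSqrt2-go N k) * suc (floorDivSqrt2-go N k))
  floorDivSqrt2-go-upper N zero h = h
  floorDivSqrt2-go-upper N (suc k) h with 2 * (suc k * suc k) ≤ᵇ N * N in eq
  ... | true  = h
  ... | false = floorDivSqrt2-go-upper N k (≰⇒> (λ le → subst T eq (≤⇒≤ᵇ le)))

  floorDivSqrt2-isFloor : ∀ N → IsFloorDivSqrt2 N (floorDivSqrt2 N)
  floorDivSqrt2-isFloor N =
    bounds (floorDivSqrt2-go-lower N N)
           (floorDivSqrt2-go-upper N N (<-≤-trans (*-mono-< (n<1+n N) (n<1+n N)) (m≤m+n _ _)))

  isFloorDivSqrt2-unique : ∀ {N m m′} → IsFloorDivSqrt2 N m → IsFloorDivSqrt2 N m′ → m ≡ m′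
  isFloorDivSqrt2-unique {m = m} {m′} (bounds lo hi) (bounds lo′ hi′) with <-cmp m m′
  ... | tri< m<m′ _ _ = ⊥-elim (<⇒≱ hi (≤-trans (*-monoʳ-≤ 2 (*-mono-≤ m<m′ m<m′)) lo′))
  ... | tri≈ _ m≡m′ _ = m≡m′
  ... | tri> _ _ m′<m = ⊥-elim (<⇒≱ hi′ (≤-trans (*-monoʳ-≤ 2 (*-mono-≤ m′<m m′<m)) lo))

  isFloorDivSqrt2-suc : ∀ {N q} → IsFloorDivSqrt2 N q →
                        IsFloorDivSqrt2 (suc N) q ⊎ IsFloorDivSqrt2 (suc N) (suc q)
  isFloorDivSqrt2-suc {N} {q} (bounds lo hi) with 2 * (suc q * suc q) ≤? suc N * suc N
  ... | no  ¬lo′ = inj₁ (bounds (≤-trans lo (*-mono-≤ (n≤1+n N) (n≤1+n N))) (≰⇒> ¬lo′))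
  ... | yes lo′  = inj₂ (bounds lo′ hi′)
    where
    open ≤-Reasoning
    N≤2[1+q] : N ≤ 2 * suc q
    N≤2[1+q] = <⇒≤ (m*m<n*n⇒m<n (begin-strict
      N * N                                     <⟨ hi ⟩
      2 * (suc q * suc q)                       ≤⟨ m≤m+n _ (2 * (suc q * suc q)) ⟩
      2 * (suc q * suc q) + 2 * (suc q * suc q) ≡⟨ solve (q ∷ []) ⟩
      2 * suc q * (2 * suc q)                   ∎))
    hi′ : suc N * suc N < 2 * (suc (suc q) * suc (suc q))
    hi′ = begin-strict
      suc N * suc N                       ≡⟨ solve (N ∷ []) ⟩
      N * N + (2 * N + 1)                 <⟨ +-monoˡ-< (2 * N + 1) hi ⟩
      2 * (suc q * suc q) + (2 * N + 1)   ≤⟨ +-monoʳ-≤ (2 * (suc q * suc q))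
                                               (+-mono-≤ (*-monoʳ-≤ 2 N≤2[1+q]) (n≤1+n 1)) ⟩
      2 * (suc q * suc q) + (2 * (2 * suc q) + 2) ≡⟨ solve (q ∷ []) ⟩
      2 * (suc (suc q) * suc (suc q))     ∎

  isFloorDivSqrt2-sum-≡ : ∀ {n q} → IsFloorDivSqrt2 n q → IsFloorDivSqrt2 (suc n) q →
                          IsFloorDivSqrt2 (suc (q + q)) n
  isFloorDivSqrt2-sum-≡ {n} {q} (bounds lo _) (bounds _ hi) = bounds lo′ hi′
    where
    open ≤-Reasoning
    q≤n : q ≤ n
    q≤n = m*m≤n*n⇒m≤n (≤-trans (m≤m+n (q * q) (q * q + 0)) lo)
    lo′ : 2 * (n * n) ≤ suc (q + q) * suc (q + q)
    lo′ = +-cancelʳ-≤ (4 * q + 4) _ _ (begin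
      2 * (n * n) + (4 * q + 4)                   ≤⟨ +-monoʳ-≤ (2 * (n * n))
                                                       (+-monoˡ-≤ 4 (*-monoʳ-≤ 4 q≤n)) ⟩
      2 * (n * n) + (4 * n + 4)                   ≡⟨ solve (n ∷ []) ⟩
      2 * suc (suc n * suc n)                     ≤⟨ *-monoʳ-≤ 2 hi ⟩
      2 * (2 * (suc q * suc q))                   ≡⟨ solve (q ∷ []) ⟩
      suc (q + q) * suc (q + q) + (4 * q + 3)     ≤⟨ +-monoʳ-≤ (suc (q + q) * suc (q + q))
                                                       (+-monoʳ-≤ (4 * q) (n≤1+n 3)) ⟩
      suc (q + q) * suc (q + q) + (4 * q + 4)     ∎)
    hi′ : suc (q + q) * suc (q + q) < 2 * (suc n * suc n)
    hi′ = begin-strict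
      suc (q + q) * suc (q + q)       ≡⟨ solve (q ∷ []) ⟩
      2 * (2 * (q * q)) + 4 * q + 1   ≤⟨ +-monoˡ-≤ 1 (+-mono-≤ (*-monoʳ-≤ 2 lo) (*-monoʳ-≤ 4 q≤n)) ⟩
      2 * (n * n) + 4 * n + 1         <⟨ +-monoʳ-< (2 * (n * n) + 4 * n) (n<1+n 1) ⟩
      2 * (n * n) + 4 * n + 2         ≡⟨ solve (n ∷ []) ⟩
      2 * (suc n * suc n)             ∎

  isFloorDivSqrt2-sum-suc : ∀ {n q} → IsFloorDivSqrt2 n q → IsFloorDivSqrt2 (suc n) (suc q) →
                            IsFloorDivSqrt2 (suc (suc q + q)) n
  isFloorDivSqrt2-sum-suc {n} {q} (bounds _ hi) (bounds lo _) = bounds lo′ hi′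
    where
    [2+2q]²≡2*2*[1+q]² : suc (suc q + q) * suc (suc q + q) ≡ 2 * (2 * (suc q * suc q))
    [2+2q]²≡2*2*[1+q]² = solve (q ∷ [])
    2*[1+q]²≢[1+n]² : 2 * (suc q * suc q) ≢ suc n * suc n
    2*[1+q]²≢[1+n]² eq = 1+n≢0 (2*m*m≡n*n⇒n≡0 (suc n) (suc q) eq)
    lo′ : 2 * (n * n) ≤ suc (suc q + q) * suc (suc q + q)
    lo′ = ≤-trans (*-monoʳ-≤ 2 (<⇒≤ hi)) (≤-reflexive (sym [2+2q]²≡2*2*[1+q]²))
    hi′ : suc (suc q + q) * suc (suc q + q) < 2 * (suc n * suc n)
    hi′ = subst (_< 2 * (suc n * suc n)) (sym [2+2q]²≡2*2*[1+q]²)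
                (*-monoʳ-< 2 (≤∧≢⇒< lo 2*[1+q]²≢[1+n]²))

  isFloorDivSqrt2-sum : ∀ {n p q} → IsFloorDivSqrt2 n q → IsFloorDivSqrt2 (suc n) p →
                        IsFloorDivSqrt2 (suc (p + q)) n
  isFloorDivSqrt2-sum fq fp with isFloorDivSqrt2-suc fq
  ... | inj₁ fq′ rewrite isFloorDivSqrt2-unique fp fq′ = isFloorDivSqrt2-sum-≡ fq fq′
  ... | inj₂ fq′ rewrite isFloorDivSqrt2-unique fp fq′ = isFloorDivSqrt2-sum-suc fq fq′

  floorDivSqrt2-sum : ∀ n → floorDivSqrt2 (suc (floorDivSqrt2 (suc n) + floorDivSqrt2 n)) ≡ n
  floorDivSqrt2-sum n = isFloorDivSqrt2-unique (floorDivSqrt2-isFloor _)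
    (isFloorDivSqrt2-sum (floorDivSqrt2-isFloor n) (floorDivSqrt2-isFloor (suc n)))

open FloorDivSqrt2Properties using (floorDivSqrt2-sum)
open import Data.Integer using (ℤ; +_; _+_; _-_; _≤_; +≤+)
open import Data.Nat as ℕ using (ℕ; zero; suc)

a-+ : ∀ m → a (+ m) ≡ + floorDivSqrt2 (suc m)
a-+ zero    = refl
a-+ (suc m) = refl

theorem1p1 : ∀ (n : ℤ) → + 1 ≤ n → a (a n + a (n - + 1)) ≡ n
theorem1p1 (+ zero)  (+≤+ ())
theorem1p1 (+ suc k) _ = begin
  a (a (+ suc k) + a (+ k))        ≡⟨ cong (λ x → a (a (+ suc k) + x)) (a-+ k) ⟩
  a (+ p + + q)                    ≡⟨ a-+ (p ℕ.+ q) ⟩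
  + floorDivSqrt2 (suc (p ℕ.+ q))  ≡⟨ cong +_ (floorDivSqrt2-sum (suc k)) ⟩
  + suc k                          ∎
  where
  open ≡-Reasoning
  p q : ℕ
  p = floorDivSqrt2 (suc (suc k))
  q = floorDivSqrt2 (suc k)
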